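{- Let $(G=(U\cup V,E),C,\mathrm{col},\ell)$ be an instance of \textsc{Max-Min Fair Matching} in which $G$ is a complete bipartite graph, with $n=|U|$, $k=|V|$, and $C=\{c_1,\dots,c_{|C|}\}$ ordered so that $|U_{c_i}|\ge|U_{c_{i+1}}|$ for all $i\in[1,|C|-1]$. Then the instance is a yes-instance if and only if $|U_{c_1}|\le \ell k+|U_{c_{|C|}}|$. With the non-emptiness constraint, the instance is a yes-instance if and only if it satisfies $|U_{c_1}|\le \ell k+|U_{c_{|C|}}|$ and additionally either ($\ell>0$ and $n\ge k$) or ($\ell=0$ and $|U_{c_1}|\ge k$).
   Context: For a bipartite graph $G=(U\cup V,E)$ with left side $U$ and right side $V$, a vertex $w$ and $M\subseteq E$, let $M(w)=\{w' \mid \{w,w'\}\in M\}$. A many-to-one matching is a set $M\subseteq E$ with $|M(u)|\le 1$ for every $u\in U$; it is left-perfect if $|M(u)|=1$ for every $u\in U$. Let $C$ be a finite set of colors and $\mathrm{col}\colon U\to C$; for $U'\subseteq U$ and $c\in C$ let $U'_c=\{u\in U'\mid \mathrm{col}(u)=c\}$. Define $\mathrm{MaxMin}(U')=\max_{c\in C}|U'_c|-\min_{c\in C}|U'_c|$ (over all colors of $C$). For an integer $\ell\ge0$, $U'$ is $\ell$-fair if $\mathrm{MaxMin}(U')\le\ell$, and $M$ is $\ell$-fair if $M(v)$ is $\ell$-fair for every $v\in V$. An instance $(G,C,\mathrm{col},\ell)$ of \textsc{Max-Min Fair Matching} is a yes-instance if there is an $\ell$-fair left-perfect many-to-one matching in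 $G$; with the non-emptiness constraint one additionally requires $M(v)\neq\emptyset$ for every $v\in V$. -}

module Defs where

open import Data.Nat using (ℕ; zero; suc; _+_; _*_; _∸_; _≤_; _<_; _⊔_; _⊓_)
open import Data.Bool using (Bool; true; false; _∧_)
open import Data.Fin using (Fin; zero; suc; _≟_; inject₁; fromℕ)
open import Data.Fin.Permutation using (Permutation′; _⟨$⟩ʳ_)
open import Data.Product using (Σ; ∃; _×_; _,_)
open import Relation.Nullary using (does)
open import Relation.Binary.PropositionalEquality using (_≡_)

count : ∀ {n} → (Fin n → Bool) → ℕ
count {zero}  P = 0
count {suc n} P = (if-b (P zero)) + count (λ i → P (suc i))
  where
  if-b : Bool → ℕ
  if-b true  = 1
  if-b false = 0

maxC : ∀ {m} → (Fin (suc m) → ℕ) → ℕ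
maxC {zero}  f = f zero
maxC {suc m} f = f zero ⊔ maxC (λ i → f (suc i))

minC : ∀ {m} → (Fin (suc m) → ℕ) → ℕ
minC {zero}  f = f zero
minC {suc m} f = f zero ⊓ minC (λ i → f (suc i))

-- Setting: U = Fin n (left side), V = Fin k (right side),
-- colors C = Fin (suc m) (so |C| = suc m ≥ 1), col : Fin n → Fin (suc m).

Graph : ℕ → ℕ → Set
Graph n k = Fin n → Fin k → Bool

CompleteBipartite : ∀ {n k} → Graph n k → Set
CompleteBipartite E = ∀ u v → E u v ≡ true

Subgraph : ∀ {n k} → Graph n k → (Fin n → Fin k → Bool) → Set
Subgraph E M = ∀ u v → M u v ≡ true → E u v ≡ true

ManyToOne : ∀ {n k} → (Fin n → Fin k → Bool) → Set
ManyToOne M = ∀ u → count (λ v → M u v) ≤ 1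

LeftPerfect : ∀ {n k} → (Fin n → Fin k → Bool) → Set
LeftPerfect M = ∀ u → count (λ v → M u v) ≡ 1

colorCount : ∀ {n m} → (Fin n → Fin (suc m)) → (Fin n → Bool) → Fin (suc m) → ℕ
colorCount col U' c = count (λ u → U' u ∧ does (col u ≟ c))

MaxMin : ∀ {n m} → (Fin n → Fin (suc m)) → (Fin n → Bool) → ℕ
MaxMin col U' = maxC (colorCount col U') ∸ minC (colorCount col U')

FairSet : ∀ {n m} → (Fin n → Fin (suc m)) → ℕ → (Fin n → Bool) → Set
FairSet col ℓ U' = MaxMin col U' ≤ ℓ

Mof : ∀ {n k} → (Fin n → Fin k → Bool) → Fin k → (Fin n → Bool)
Mof M v = λ u → M u v

FairMatching : ∀ {n k m} → (Fin n → Fin (suc m)) → ℕ → (Fin n → Fin k → Bool) → Set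
FairMatching col ℓ M = ∀ v → FairSet col ℓ (Mof M v)

YesInstance : ∀ {n k m} → Graph n k → (Fin n → Fin (suc m)) → ℕ → Set
YesInstance E col ℓ =
  ∃ λ M → Subgraph E M × ManyToOne M × LeftPerfect M × FairMatching col ℓ M

YesInstanceNE : ∀ {n k m} → Graph n k → (Fin n → Fin (suc m)) → ℕ → Set
YesInstanceNE E col ℓ =
  ∃ λ M → Subgraph E M × ManyToOne M × LeftPerfect M × FairMatching col ℓ M
        × (∀ v → ∃ λ u → M u v ≡ true)

classSize : ∀ {n m} → (Fin n → Fin (suc m)) → Fin (suc m) → ℕ
classSize col c = count (λ u → does (col u ≟ c))

-- σ lists the colors c_1 = σ 0, …, c_{|C|} = σ m with |U_{c_i}| ≥ |U_{c_{i+1}}|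
SortedColors : ∀ {n m} → (Fin n → Fin (suc m)) → Permutation′ (suc m) → Set
SortedColors {m = m} col σ =
  ∀ (i : Fin m) → classSize col (σ ⟨$⟩ʳ suc i) ≤ classSize col (σ ⟨$⟩ʳ inject₁ i)

{-# OPTIONS --safe #-}
-- Summing the colour-c share of M(v) over all v gives |U_c| for any left-perfect M, so ℓ-fairness
-- of every M(v) yields |U_c| ≤ ℓ·k + |U_c′| for all colours c, c′; for sorted colours this is the
-- single inequality |U_c₁| ≤ ℓ·k + |U_c|C||.  Conversely, deal every colour class out round robin
-- over V, starting at slot 0: a class of size a gives v the number of i < a with i ≡ v (mod k),
-- which is monotone in a and grows by exactly ℓ when a grows by ℓ·k, so the inequality makes the
-- matching ℓ-fair, and every v is reached once some class has at least k elements.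
-- With the non-emptiness constraint, distinct v need distinct partners (so k ≤ n), and for ℓ = 0
-- every class must meet every v (so all classes have size ≥ k).  If instead ℓ > 0, n ≥ k and all
-- classes are smaller than k, deal all of U out in one sweep, class after class: each class meets
-- each v at most once, so the matching is 1-fair, and the sweep of length n reaches every v.
module Submission where

open import Defs
open import Data.Bool using (Bool; true; false; _∧_)
open import Data.Bool.Properties using (∧-identityʳ; ∧-zeroʳ; ∧-conicalˡ)
open import Data.Empty using (⊥-elim)
open import Data.Fin using (Fin; zero; suc; toℕ; fromℕ; inject₁; _≟_)
open import Data.Fin.Permutation using (Permutation′; _⟨$⟩ʳ_; _⟨$⟩ˡ_; inverseʳ)
open import Data.Fin.Properties using (toℕ<n; injective⇒≤; any?)
import Data.Nat as N
open import Data.Nat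
  using (ℕ; zero; suc; _+_; _*_; _∸_; _≤_; _<_; _≥_; z≤n; s≤s; z<s; NonZero; _%_; >-nonZero)
open import Data.Nat.DivMod using (m%n<n; m<n⇒m%n≡m; [m+n]%n≡m%n)
open import Data.Nat.Properties hiding (_≟_)
open import Data.Product using (∃; _×_; _,_; proj₁; proj₂)
open import Data.Sum using (_⊎_; inj₁; inj₂)
open import Function.Base using (_∘_)
open import Function.Bundles using (_⇔_; mk⇔; Equivalence)
open import Function.Construct.Composition using (_⇔-∘_)
open import Function.Construct.Identity using (⇔-id)
open import Data.Product.Function.NonDependent.Propositional using (_×-⇔_)
open import Data.Sum.Function.Propositional using (_⊎-⇔_)
open import Relation.Nullary using (does; yes; no)
open import Relation.Nullary.Decidable using (does-⇔; dec-true)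
open import Relation.Binary.PropositionalEquality

open import Algebra.Properties.CommutativeMonoid.Sum +-0-commutativeMonoid
  using (sum; ∑-comm; ∑-distrib-+; sum-cong-≗; sum-replicate-zero)

indicator : Bool → ℕ
indicator true  = 1
indicator false = 0

count-suc : ∀ {n} (P : Fin (suc n) → Bool) → count P ≡ indicator (P zero) + count (P ∘ suc)
count-suc P with P zero
... | true  = refl
... | false = refl

count≡∑ : ∀ {n} (P : Fin n → Bool) → count P ≡ sum (indicator ∘ P)
count≡∑ {zero}  P = refl
count≡∑ {suc n} P = trans (count-suc P) (cong (indicator (P zero) +_) (count≡∑ (P ∘ suc)))

count-cong : ∀ {n} {P Q : Fin n → Bool} → (∀ i → P i ≡ Q i) → count P ≡ count Q
count-cong {P = P} {Q} P≗Q =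
  trans (count≡∑ P) (trans (sum-cong-≗ (cong indicator ∘ P≗Q)) (sym (count≡∑ Q)))

count-false : ∀ n → count {n} (λ _ → false) ≡ 0
count-false n = trans (count≡∑ {n} (λ _ → false)) (sum-replicate-zero n)

count-≥1 : ∀ {n} (P : Fin n → Bool) i → P i ≡ true → 1 ≤ count P
count-≥1 P zero    Pi rewrite count-suc P | Pi = s≤s z≤n
count-≥1 P (suc i) Pi rewrite count-suc P = ≤-trans (count-≥1 (P ∘ suc) i Pi) (m≤n+m _ _)

count-≥1⇒∃ : ∀ {n} (P : Fin n → Bool) → 1 ≤ count P → ∃ λ i → P i ≡ true
count-≥1⇒∃ {suc n} P 1≤P rewrite count-suc P with P zero in P₀
... | true  = zero , P₀
... | false = let i , Pi = count-≥1⇒∃ (P ∘ suc) 1≤P in suc i , Pi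

count≤1⇒unique : ∀ {n} (P : Fin n → Bool) → count P ≤ 1 →
                 ∀ {i j} → P i ≡ true → P j ≡ true → i ≡ j
count≤1⇒unique P P≤1 {zero}  {zero}  _  _  = refl
count≤1⇒unique P P≤1 {zero}  {suc j} Pi Pj = ⊥-elim (1+n≰n (≤-trans (count-≥2 P j Pi Pj) P≤1))
  where
  count-≥2 : ∀ {n} (P : Fin (suc n) → Bool) j → P zero ≡ true → P (suc j) ≡ true → 2 ≤ count P
  count-≥2 P j P₀ Pj rewrite count-suc P | P₀ = s≤s (count-≥1 (P ∘ suc) j Pj)
count≤1⇒unique P P≤1 {suc i} {zero}  Pi Pj = sym (count≤1⇒unique P P≤1 Pj Pi)
count≤1⇒unique P P≤1 {suc i} {suc j} Pi Pj =
  cong suc (count≤1⇒unique (P ∘ suc) (≤-trans tail≤ P≤1) Pi Pj)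
  where
  tail≤ : count (P ∘ suc) ≤ count P
  tail≤ = subst (count (P ∘ suc) ≤_) (sym (count-suc P)) (m≤n+m _ _)

count-≟ : ∀ {n} (w : Fin n) → count (λ i → does (w ≟ i)) ≡ 1
count-≟ {suc n} zero    = cong suc (count-false n)
count-≟ {suc n} (suc w) = count-≟ w

countBelow : ℕ → (ℕ → Bool) → ℕ
countBelow zero    h = 0
countBelow (suc a) h = indicator (h 0) + countBelow a (h ∘ suc)

count∘toℕ : ∀ {n} (h : ℕ → Bool) → count {n} (h ∘ toℕ) ≡ countBelow n h
count∘toℕ {zero}  h = refl
count∘toℕ {suc n} h =
  trans (count-suc {n} (h ∘ toℕ)) (cong (indicator (h 0) +_) (count∘toℕ {n} (h ∘ suc)))

countBelow-cong : ∀ a {h h′ : ℕ → Bool} → (∀ i → i < a → h i ≡ h′ i) →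
                  countBelow a h ≡ countBelow a h′
countBelow-cong zero    h≗h′ = refl
countBelow-cong (suc a) h≗h′ =
  cong₂ _+_ (cong indicator (h≗h′ 0 z<s)) (countBelow-cong a (λ i i<a → h≗h′ (suc i) (s≤s i<a)))

countBelow-+ : ∀ a b h → countBelow (a + b) h ≡ countBelow a h + countBelow b (h ∘ (a +_))
countBelow-+ zero    b h = refl
countBelow-+ (suc a) b h = trans (cong (indicator (h 0) +_) (countBelow-+ a b (h ∘ suc)))
  (sym (+-assoc (indicator (h 0)) (countBelow a (h ∘ suc)) _))

countBelow-mono : ∀ h {a b} → a ≤ b → countBelow a h ≤ countBelow b h
countBelow-mono h {a} a≤b with m≤n⇒∃[o]m+o≡n a≤b
... | d , refl = subst (countBelow a h ≤_) (sym (countBelow-+ a d h)) (m≤m+n _ _)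

countBelow-≟ : ∀ {a j} → j < a → countBelow a (λ i → does (j N.≟ i)) ≡ 1
countBelow-≟ {suc a} {zero}  _         = cong suc (trans (sym (count∘toℕ {a} _)) (count-false a))
countBelow-≟ {suc a} {suc j} (s≤s j<a) = countBelow-≟ j<a

∑-mono-≤ : ∀ {n} {f g : Fin n → ℕ} → (∀ i → f i ≤ g i) → sum f ≤ sum g
∑-mono-≤ {zero}  f≤g = z≤n
∑-mono-≤ {suc n} f≤g = +-mono-≤ (f≤g zero) (∑-mono-≤ (f≤g ∘ suc))

∑-const : ∀ n c → sum {n} (λ _ → c) ≡ n * c
∑-const zero    c = refl
∑-const (suc n) c = cong (c +_) (∑-const n c)

count-swap : ∀ {n k} (R : Fin n → Fin k → Bool) →
             sum (λ v → count (λ u → R u v)) ≡ sum (λ u → count (R u))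
count-swap R = begin
  sum (λ v → count (λ u → R u v))            ≡⟨ sum-cong-≗ (λ v → count≡∑ (λ u → R u v)) ⟩
  sum (λ v → sum (λ u → indicator (R u v)))  ≡⟨ ∑-comm (λ v u → indicator (R u v)) ⟩
  sum (λ u → sum (λ v → indicator (R u v)))  ≡⟨ sum-cong-≗ (λ u → count≡∑ (R u)) ⟨
  sum (λ u → count (R u))                    ∎
  where open ≡-Reasoning

∑-classSize : ∀ {n m} (col : Fin n → Fin (suc m)) → sum (classSize col) ≡ n
∑-classSize {n} col = begin
  sum (classSize col)                         ≡⟨ count-swap (λ u c → does (col u ≟ c)) ⟩
  sum (λ u → count (λ c → does (col u ≟ c)))  ≡⟨ sum-cong-≗ (count-≟ ∘ col) ⟩
  sum {n} (λ _ → 1)                           ≡⟨ ∑-const n 1 ⟩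
  n * 1                                       ≡⟨ *-identityʳ n ⟩
  n                                           ∎
  where open ≡-Reasoning

∑-colorCount : ∀ {n k m} (col : Fin n → Fin (suc m)) (M : Fin n → Fin k → Bool) → LeftPerfect M →
               ∀ c → sum (λ v → colorCount col (Mof M v) c) ≡ classSize col c
∑-colorCount {n} {k} col M perfect c = begin
  sum (λ v → colorCount col (Mof M v) c)       ≡⟨ count-swap (λ u v → M u v ∧ inClass u) ⟩
  sum (λ u → count (λ v → M u v ∧ inClass u))  ≡⟨ sum-cong-≗ row ⟩
  sum (λ u → indicator (inClass u))            ≡⟨ count≡∑ inClass ⟨
  classSize col c                              ∎
  where
  open ≡-Reasoning
  inClass : Fin n → Bool
  inClass u = does (col u ≟ c)
  row : ∀ u → count (λ v → M u v ∧ inClass u) ≡ indicator (inClass u)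
  row u with inClass u
  ... | true  = trans (count-cong (λ v → ∧-identityʳ (M u v))) (perfect u)
  ... | false = trans (count-cong (λ v → ∧-zeroʳ (M u v))) (count-false k)

maxC-ub : ∀ {m} (f : Fin (suc m) → ℕ) c → f c ≤ maxC f
maxC-ub {zero}  f zero    = ≤-refl
maxC-ub {suc m} f zero    = m≤m⊔n _ _
maxC-ub {suc m} f (suc c) = ≤-trans (maxC-ub (f ∘ suc) c) (m≤n⊔m _ _)

maxC-lub : ∀ {m} (f : Fin (suc m) → ℕ) {b} → (∀ c → f c ≤ b) → maxC f ≤ b
maxC-lub {zero}  f f≤b = f≤b zero
maxC-lub {suc m} f f≤b = ⊔-lub (f≤b zero) (maxC-lub (f ∘ suc) (f≤b ∘ suc))

minC-lb : ∀ {m} (f : Fin (suc m) → ℕ) c → minC f ≤ f c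
minC-lb {zero}  f zero    = ≤-refl
minC-lb {suc m} f zero    = m⊓n≤m _ _
minC-lb {suc m} f (suc c) = ≤-trans (m⊓n≤n _ _) (minC-lb (f ∘ suc) c)

minC-glb : ∀ {m} (f : Fin (suc m) → ℕ) {b} → (∀ c → b ≤ f c) → b ≤ minC f
minC-glb {zero}  f b≤f = b≤f zero
minC-glb {suc m} f b≤f = ⊓-glb (b≤f zero) (minC-glb (f ∘ suc) (b≤f ∘ suc))

maxC∸minC≤⇔ : ∀ {m} (f : Fin (suc m) → ℕ) d → (maxC f ∸ minC f ≤ d) ⇔ (∀ c c′ → f c ≤ d + f c′)
maxC∸minC≤⇔ f d = mk⇔ pairwise spread
  where
  pairwise : maxC f ∸ minC f ≤ d → ∀ c c′ → f c ≤ d + f c′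
  pairwise spread≤d c c′ = begin
    f c                         ≤⟨ maxC-ub f c ⟩
    maxC f                      ≤⟨ m≤n+m∸n (maxC f) (minC f) ⟩
    minC f + (maxC f ∸ minC f)  ≤⟨ +-mono-≤ (minC-lb f c′) spread≤d ⟩
    f c′ + d                    ≡⟨ +-comm (f c′) d ⟩
    d + f c′                    ∎
    where open ≤-Reasoning
  spread : (∀ c c′ → f c ≤ d + f c′) → maxC f ∸ minC f ≤ d
  spread f≤d+f =
    m≤n+o⇒m∸n≤o (maxC f) (minC f) (subst (maxC f ≤_) (+-comm d (minC f)) (maxC-lub f below))
    where
    below : ∀ c → f c ≤ d + minC f
    below c = ≤-trans (m≤n+m∸n (f c) d)
      (+-monoʳ-≤ d (minC-glb f (λ c′ → m≤n+o⇒m∸n≤o (f c) d (f≤d+f c c′))))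

Balanced : ∀ {n m} → (Fin n → Fin (suc m)) → ℕ → Set
Balanced col d = ∀ c c′ → classSize col c ≤ d + classSize col c′

descending⇒≤-first : ∀ {m} (g : Fin (suc m) → ℕ) → (∀ (i : Fin m) → g (suc i) ≤ g (inject₁ i)) →
                     ∀ i → g i ≤ g zero
descending⇒≤-first {zero}  g desc zero    = ≤-refl
descending⇒≤-first {suc m} g desc zero    = ≤-refl
descending⇒≤-first {suc m} g desc (suc i) =
  ≤-trans (desc i) (descending⇒≤-first (g ∘ inject₁) (desc ∘ inject₁) i)

descending⇒last-≤ : ∀ {m} (g : Fin (suc m) → ℕ) → (∀ (i : Fin m) → g (suc i) ≤ g (inject₁ i)) →
                    ∀ i → g (fromℕ m) ≤ g i
descending⇒last-≤ {zero}  g desc zero    = ≤-refl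
descending⇒last-≤ {suc m} g desc zero    =
  ≤-trans (descending⇒last-≤ (g ∘ suc) (desc ∘ suc) zero) (desc zero)
descending⇒last-≤ {suc m} g desc (suc i) = descending⇒last-≤ (g ∘ suc) (desc ∘ suc) i

module _ {n m} (col : Fin n → Fin (suc m)) (σ : Permutation′ (suc m)) (sorted : SortedColors col σ)
  where

  sorted⇒≤-first : ∀ c → classSize col c ≤ classSize col (σ ⟨$⟩ʳ zero)
  sorted⇒≤-first c = subst (λ c → classSize col c ≤ _) (inverseʳ σ)
    (descending⇒≤-first (classSize col ∘ (σ ⟨$⟩ʳ_)) sorted (σ ⟨$⟩ˡ c))

  sorted⇒last-≤ : ∀ c → classSize col (σ ⟨$⟩ʳ fromℕ m) ≤ classSize col c
  sorted⇒last-≤ c = subst (λ c → _ ≤ classSize col c) (inverseʳ σ)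
    (descending⇒last-≤ (classSize col ∘ (σ ⟨$⟩ʳ_)) sorted (σ ⟨$⟩ˡ c))

  sorted⇒balanced⇔ : ∀ d → Balanced col d
                         ⇔ (classSize col (σ ⟨$⟩ʳ zero) ≤ d + classSize col (σ ⟨$⟩ʳ fromℕ m))
  sorted⇒balanced⇔ d = mk⇔ (λ balanced → balanced _ _) λ extremes c c′ →
    ≤-trans (sorted⇒≤-first c) (≤-trans extremes (+-monoʳ-≤ d (sorted⇒last-≤ c′)))

  sorted⇒∃≤⇔≤-first : ∀ b → (∃ λ c → b ≤ classSize col c) ⇔ (b ≤ classSize col (σ ⟨$⟩ʳ zero))
  sorted⇒∃≤⇔≤-first b = mk⇔ (λ (c , b≤c) → ≤-trans b≤c (sorted⇒≤-first c)) (λ b≤first → _ , b≤first)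

module Residues (K : ℕ) .{{_ : NonZero K}} where

  #residue : Fin K → ℕ → ℕ
  #residue j a = countBelow a (λ i → does (i % K N.≟ toℕ j))

  #residue-mono : ∀ j {a b} → a ≤ b → #residue j a ≤ #residue j b
  #residue-mono j = countBelow-mono (λ i → does (i % K N.≟ toℕ j))

  #residue-K : ∀ j → #residue j K ≡ 1
  #residue-K j = trans (countBelow-cong K below) (countBelow-≟ (toℕ<n j))
    where
    below : ∀ i → i < K → does (i % K N.≟ toℕ j) ≡ does (toℕ j N.≟ i)
    below i i<K rewrite m<n⇒m%n≡m i<K = does-⇔ (mk⇔ sym sym) (i N.≟ toℕ j) (toℕ j N.≟ i)

  #residue-period : ∀ j b → #residue j (K + b) ≡ 1 + #residue j b
  #residue-period j b = trans (countBelow-+ K b _) (cong₂ _+_ (#residue-K j) (countBelow-cong b shift))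
    where
    shift : ∀ i → i < b → does ((K + i) % K N.≟ toℕ j) ≡ does (i % K N.≟ toℕ j)
    shift i _ = cong (λ r → does (r N.≟ toℕ j)) (trans (cong (_% K) (+-comm K i)) ([m+n]%n≡m%n i K))

  #residue-multiple : ∀ j ℓ a → #residue j (ℓ * K + a) ≡ ℓ + #residue j a
  #residue-multiple j zero    a = refl
  #residue-multiple j (suc ℓ) a = begin
    #residue j (K + ℓ * K + a)   ≡⟨ cong (#residue j) (+-assoc K (ℓ * K) a) ⟩
    #residue j (K + (ℓ * K + a)) ≡⟨ #residue-period j (ℓ * K + a) ⟩
    1 + #residue j (ℓ * K + a)   ≡⟨ cong suc (#residue-multiple j ℓ a) ⟩
    suc ℓ + #residue j a         ∎
    where open ≡-Reasoning

rank : ∀ {n m} → (Fin n → Fin (suc m)) → Fin n → ℕ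
rank col zero    = 0
rank col (suc u) = indicator (does (col zero ≟ col (suc u))) + rank (col ∘ suc) u

countBelow-indicator+ : ∀ b s h →
  countBelow (indicator b + s) h ≡ indicator (b ∧ h 0) + countBelow s (h ∘ (indicator b +_))
countBelow-indicator+ true  s h = refl
countBelow-indicator+ false s h = refl

count-rank : ∀ {n m} (col : Fin n → Fin (suc m)) c (h : ℕ → Bool) →
             count (λ u → does (col u ≟ c) ∧ h (rank col u)) ≡ countBelow (classSize col c) h
count-rank {zero}  col c h = refl
count-rank {suc n} col c h = begin
  count (λ u → does (col u ≟ c) ∧ h (rank col u))
    ≡⟨ count-suc (λ u → does (col u ≟ c) ∧ h (rank col u)) ⟩
  indicator (first ∧ h 0) + count (λ u → does (col (suc u) ≟ c) ∧ h (rank col (suc u)))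
    ≡⟨ cong (indicator (first ∧ h 0) +_) (count-cong same-colour) ⟩
  indicator (first ∧ h 0) + count (λ u → does (col (suc u) ≟ c) ∧ h′ (rank (col ∘ suc) u))
    ≡⟨ cong (indicator (first ∧ h 0) +_) (count-rank (col ∘ suc) c h′) ⟩
  indicator (first ∧ h 0) + countBelow (classSize (col ∘ suc) c) h′
    ≡⟨ sym (countBelow-indicator+ first (classSize (col ∘ suc) c) h) ⟩
  countBelow (indicator first + classSize (col ∘ suc) c) h
    ≡⟨ cong (λ s → countBelow s h) (sym (count-suc (λ u → does (col u ≟ c)))) ⟩
  countBelow (classSize col c) h
    ∎
  where
  open ≡-Reasoning
  first : Bool
  first = does (col zero ≟ c)
  h′ : ℕ → Bool
  h′ i = h (indicator first + i)
  same-colour : ∀ u → (does (col (suc u) ≟ c) ∧ h (rank col (suc u)))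
                    ≡ (does (col (suc u) ≟ c) ∧ h′ (rank (col ∘ suc) u))
  same-colour u with col (suc u) ≟ c
  ... | yes refl = refl
  ... | no _     = refl

module RoundRobin {n m} (col : Fin n → Fin (suc m)) (K : ℕ) .{{_ : NonZero K}}
                  (offset : Fin (suc m) → ℕ) where
  open Residues K public

  slot : Fin n → ℕ
  slot u = offset (col u) + rank col u

  roundRobin : Fin n → Fin K → Bool
  roundRobin u v = does (slot u % K N.≟ toℕ v)

  roundRobin-leftPerfect : LeftPerfect roundRobin
  roundRobin-leftPerfect u =
    trans (count∘toℕ {K} (λ j → does (slot u % K N.≟ j))) (countBelow-≟ (m%n<n (slot u) K))

  #residue+colorCount : ∀ v c → #residue v (offset c) + colorCount col (Mof roundRobin v) c
                               ≡ #residue v (offset c + classSize col c)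
  #residue+colorCount v c = begin
    #residue v (offset c) + colorCount col (Mof roundRobin v) c
      ≡⟨ cong (#residue v (offset c) +_) (trans (count-cong in-class) (count-rank col c onSlot)) ⟩
    #residue v (offset c) + countBelow (classSize col c) onSlot
      ≡⟨ sym (countBelow-+ (offset c) (classSize col c) _) ⟩
    #residue v (offset c + classSize col c)
      ∎
    where
    open ≡-Reasoning
    onSlot : ℕ → Bool
    onSlot i = does ((offset c + i) % K N.≟ toℕ v)
    in-class : ∀ u → (roundRobin u v ∧ does (col u ≟ c)) ≡ (does (col u ≟ c) ∧ onSlot (rank col u))
    in-class u with col u ≟ c
    ... | yes refl = ∧-identityʳ (roundRobin u v)
    ... | no _     = ∧-zeroʳ (roundRobin u v)

prefixSum : ∀ {m} → (Fin m → ℕ) → Fin m → ℕ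
prefixSum a zero    = 0
prefixSum a (suc c) = a zero + prefixSum (a ∘ suc) c

<-on-some-block : ∀ (Φ : ℕ → ℕ) {m} (a : Fin m → ℕ) b → Φ b < Φ (b + sum a) →
                  ∃ λ c → Φ (b + prefixSum a c) < Φ (b + prefixSum a c + a c)
<-on-some-block Φ {zero}  a b Φb<Φb = ⊥-elim (<-irrefl (cong Φ (sym (+-identityʳ b))) Φb<Φb)
<-on-some-block Φ {suc m} a b Φb<Φend with Φ b <? Φ (b + a zero)
... | yes Φb<Φb+a₀ = zero , subst (λ x → Φ x < Φ (x + a zero)) (sym (+-identityʳ b)) Φb<Φb+a₀
... | no  Φb≮Φb+a₀ with <-on-some-block Φ (a ∘ suc) (b + a zero) Φb+a₀<Φend
  where
  Φb+a₀<Φend : Φ (b + a zero) < Φ (b + a zero + sum (a ∘ suc))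
  Φb+a₀<Φend = ≤-<-trans (≮⇒≥ Φb≮Φb+a₀)
    (subst (λ x → Φ b < Φ x) (sym (+-assoc b (a zero) _)) Φb<Φend)
...   | c , Φ< = suc c , subst (λ x → Φ x < Φ (x + a (suc c))) (+-assoc b (a zero) _) Φ<

CoverCondition : ∀ {n m} → (Fin n → Fin (suc m)) → (k ℓ : ℕ) → Set
CoverCondition {n} col k ℓ = (0 < ℓ × n ≥ k) ⊎ (ℓ ≡ 0 × ∃ λ c → k ≤ classSize col c)

Covering : ∀ {n k} → (Fin n → Fin k → Bool) → Set
Covering M = ∀ v → ∃ λ u → M u v ≡ true

covering⇒≤ : ∀ {n k} {M : Fin n → Fin k → Bool} → ManyToOne M → Covering M → k ≤ n
covering⇒≤ {n} {k} {M} manyToOne covers = injective⇒≤ {f = partner} λ {v} {w} same →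
  count≤1⇒unique (M (partner v)) (manyToOne (partner v))
    (proj₂ (covers v)) (subst (λ u → M u w ≡ true) (sym same) (proj₂ (covers w)))
  where
  partner : Fin k → Fin n
  partner = proj₁ ∘ covers

colorCount≥1⇒∃ : ∀ {n k m} (col : Fin n → Fin (suc m)) (M : Fin n → Fin k → Bool) v c →
                 1 ≤ colorCount col (Mof M v) c → ∃ λ u → M u v ≡ true
colorCount≥1⇒∃ col M v c 1≤count =
  let u , inClass = count-≥1⇒∃ _ 1≤count in u , ∧-conicalˡ (M u v) _ inClass

module _ {n k m} (col : Fin n → Fin (suc m)) {M : Fin n → Fin k → Bool} (perfect : LeftPerfect M)
  where

  share : Fin k → Fin (suc m) → ℕ
  share v = colorCount col (Mof M v)

  fair⇒share-≤ : ∀ {ℓ} → FairMatching col ℓ M → ∀ v c c′ → share v c ≤ ℓ + share v c′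
  fair⇒share-≤ {ℓ} fair v = Equivalence.to (maxC∸minC≤⇔ (share v) ℓ) (fair v)

  fair⇒balanced : ∀ {ℓ} → FairMatching col ℓ M → Balanced col (ℓ * k)
  fair⇒balanced {ℓ} fair c c′ = begin
    classSize col c                           ≡⟨ ∑-colorCount col M perfect c ⟨
    sum (λ v → share v c)                     ≤⟨ ∑-mono-≤ (λ v → fair⇒share-≤ fair v c c′) ⟩
    sum (λ v → ℓ + share v c′)                ≡⟨ ∑-distrib-+ (λ _ → ℓ) (λ v → share v c′) ⟩
    sum {k} (λ _ → ℓ) + sum (λ v → share v c′) ≡⟨ cong₂ _+_ (∑-const k ℓ) (∑-colorCount col M perfect c′) ⟩
    k * ℓ + classSize col c′                  ≡⟨ cong (_+ classSize col c′) (*-comm k ℓ) ⟩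
    ℓ * k + classSize col c′                  ∎
    where open ≤-Reasoning

  0-fair∧covering⇒≤classSize : FairMatching col 0 M → Covering M → ∀ c → k ≤ classSize col c
  0-fair∧covering⇒≤classSize fair covers c = begin
    k                      ≡⟨ trans (∑-const k 1) (*-identityʳ k) ⟨
    sum {k} (λ _ → 1)      ≤⟨ ∑-mono-≤ met ⟩
    sum (λ v → share v c)  ≡⟨ ∑-colorCount col M perfect c ⟩
    classSize col c        ∎
    where
    open ≤-Reasoning
    met : ∀ v → 1 ≤ share v c
    met v = let u , Muv = covers v in
      ≤-trans (count-≥1 _ u (cong₂ _∧_ Muv (dec-true (col u ≟ col u) refl))) (fair⇒share-≤ fair v (col u) c)

module _ {n m} (col : Fin n → Fin (suc m)) (K : ℕ) .{{_ : NonZero K}} where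

  module PerClass    = RoundRobin col K (λ _ → 0)
  module Consecutive = RoundRobin col K (prefixSum (classSize col))

  perClass-fair : ∀ ℓ → Balanced col (ℓ * K) → FairMatching col ℓ PerClass.roundRobin
  perClass-fair ℓ balanced v = Equivalence.from (maxC∸minC≤⇔ _ ℓ) λ c c′ → begin
    colorCount col (Mof roundRobin v) c       ≡⟨ #residue+colorCount v c ⟩
    #residue v (classSize col c)              ≤⟨ #residue-mono v (balanced c c′) ⟩
    #residue v (ℓ * K + classSize col c′)     ≡⟨ #residue-multiple v ℓ (classSize col c′) ⟩
    ℓ + #residue v (classSize col c′)         ≡⟨ cong (ℓ +_) (#residue+colorCount v c′) ⟨
    ℓ + colorCount col (Mof roundRobin v) c′  ∎
    where
    open PerClass
    open ≤-Reasoning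

  perClass-covering : ∀ c → K ≤ classSize col c → Covering PerClass.roundRobin
  perClass-covering c K≤c v = colorCount≥1⇒∃ col roundRobin v c (begin
    1                                    ≡⟨ #residue-K v ⟨
    #residue v K                         ≤⟨ #residue-mono v K≤c ⟩
    #residue v (classSize col c)         ≡⟨ #residue+colorCount v c ⟨
    colorCount col (Mof roundRobin v) c  ∎)
    where
    open PerClass
    open ≤-Reasoning

  consecutive-colorCount≤1 : (∀ c → classSize col c ≤ K) →
                             ∀ v c → colorCount col (Mof Consecutive.roundRobin v) c ≤ 1
  consecutive-colorCount≤1 small v c = +-cancelˡ-≤ (#residue v before) _ _ (begin
    #residue v before + colorCount col (Mof roundRobin v) c  ≡⟨ #residue+colorCount v c ⟩
    #residue v (before + classSize col c)                    ≤⟨ #residue-mono v (+-monoʳ-≤ before (small c)) ⟩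
    #residue v (before + K)                                  ≡⟨ cong (#residue v) (+-comm before K) ⟩
    #residue v (K + before)                                  ≡⟨ #residue-period v before ⟩
    1 + #residue v before                                    ≡⟨ +-comm 1 (#residue v before) ⟩
    #residue v before + 1                                    ∎)
    where
    open Consecutive
    open ≤-Reasoning
    before : ℕ
    before = prefixSum (classSize col) c

  consecutive-fair : ∀ ℓ → 1 ≤ ℓ → (∀ c → classSize col c ≤ K) →
                     FairMatching col ℓ Consecutive.roundRobin
  consecutive-fair ℓ 1≤ℓ small v = Equivalence.from (maxC∸minC≤⇔ _ ℓ) λ c c′ →
    ≤-trans (consecutive-colorCount≤1 small v c) (≤-trans 1≤ℓ (m≤m+n ℓ _))

  consecutive-covering : K ≤ n → Covering Consecutive.roundRobin
  consecutive-covering K≤n v with <-on-some-block (#residue v) (classSize col) 0 reached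
    where
    open Consecutive
    open ≤-Reasoning
    reached : #residue v 0 < #residue v (sum (classSize col))
    reached = begin-strict
      #residue v 0                     <⟨ z<s ⟩
      1                                ≡⟨ #residue-K v ⟨
      #residue v K                     ≤⟨ #residue-mono v K≤n ⟩
      #residue v n                     ≡⟨ cong (#residue v) (∑-classSize col) ⟨
      #residue v (sum (classSize col)) ∎
  ... | c , grows = colorCount≥1⇒∃ col roundRobin v c (+-cancelˡ-< (#residue v before) 0 _ (begin-strict
    #residue v before + 0                                    ≡⟨ +-identityʳ _ ⟩
    #residue v before                                        <⟨ grows ⟩
    #residue v (before + classSize col c)                    ≡⟨ #residue+colorCount v c ⟨
    #residue v before + colorCount col (Mof roundRobin v) c  ∎))
    where
    open Consecutive
    open ≤-Reasoning
    before : ℕ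
    before = prefixSum (classSize col) c

module _ {n k m} {E : Graph n k} (complete : CompleteBipartite E) (col : Fin n → Fin (suc m)) where

  perfect∧fair⇒yes : ∀ {ℓ M} → LeftPerfect M → FairMatching col ℓ M → YesInstance E col ℓ
  perfect∧fair⇒yes perfect fair =
    _ , (λ u v _ → complete u v) , ≤-reflexive ∘ perfect , perfect , fair

  perfect∧fair∧covering⇒yesNE : ∀ {ℓ M} → LeftPerfect M → FairMatching col ℓ M → Covering M →
                                YesInstanceNE E col ℓ
  perfect∧fair∧covering⇒yesNE perfect fair covers =
    _ , (λ u v _ → complete u v) , ≤-reflexive ∘ perfect , perfect , fair , covers

  module _ .{{_ : NonZero k}} where

    yes⇔balanced : ∀ ℓ → YesInstance E col ℓ ⇔ Balanced col (ℓ * k)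
    yes⇔balanced ℓ = mk⇔
      (λ (_ , _ , _ , perfect , fair) → fair⇒balanced col perfect fair)
      (λ balanced → perfect∧fair⇒yes (PerClass.roundRobin-leftPerfect col k) (perClass-fair col k ℓ balanced))

    yesNE⇔balanced∧coverCondition : ∀ ℓ →
      YesInstanceNE E col ℓ ⇔ (Balanced col (ℓ * k) × CoverCondition col k ℓ)
    yesNE⇔balanced∧coverCondition ℓ = mk⇔ necessary sufficient
      where
      necessary : YesInstanceNE E col ℓ → Balanced col (ℓ * k) × CoverCondition col k ℓ
      necessary (M , _ , manyToOne , perfect , fair , covers) =
        fair⇒balanced col perfect fair , regime ℓ fair
        where
        regime : ∀ ℓ → FairMatching col ℓ M → CoverCondition col k ℓ
        regime zero    fair = inj₂ (refl , zero , 0-fair∧covering⇒≤classSize col perfect fair covers zero)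
        regime (suc _) _    = inj₁ (z<s , covering⇒≤ manyToOne covers)

      sufficient : Balanced col (ℓ * k) × CoverCondition col k ℓ → YesInstanceNE E col ℓ
      sufficient (balanced , regime) with any? (λ c → k ≤? classSize col c) | regime
      ... | yes (c , k≤c) | _ =
        perfect∧fair∧covering⇒yesNE (PerClass.roundRobin-leftPerfect col k)
          (perClass-fair col k ℓ balanced) (perClass-covering col k c k≤c)
      ... | no ¬large | inj₂ (_ , large) = ⊥-elim (¬large large)
      ... | no ¬large | inj₁ (0<ℓ , k≤n) =
        perfect∧fair∧covering⇒yesNE (Consecutive.roundRobin-leftPerfect col k)
          (consecutive-fair col k ℓ 0<ℓ small) (consecutive-covering col k k≤n)
        where
        small : ∀ c → classSize col c ≤ k
        small c = <⇒≤ (≰⇒> (¬large ∘ (c ,_)))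

theorem27 : ∀ {n k m : ℕ} (E : Graph n k) (col : Fin n → Fin (suc m)) (ℓ : ℕ)
    → CompleteBipartite E
    → 1 ≤ k
    → (σ : Permutation′ (suc m)) → SortedColors col σ
    → (YesInstance E col ℓ
         ⇔ (classSize col (σ ⟨$⟩ʳ zero) ≤ ℓ * k + classSize col (σ ⟨$⟩ʳ fromℕ m)))
      × (YesInstanceNE E col ℓ
         ⇔ ((classSize col (σ ⟨$⟩ʳ zero) ≤ ℓ * k + classSize col (σ ⟨$⟩ʳ fromℕ m))
            × ((0 < ℓ × n ≥ k) ⊎ (ℓ ≡ 0 × classSize col (σ ⟨$⟩ʳ zero) ≥ k))))
theorem27 {k = k} {m} E col ℓ complete 1≤k σ sorted =
    balanced⇔extremes ⇔-∘ yes⇔balanced complete col ℓ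
  , (balanced⇔extremes ×-⇔ (⇔-id _ ⊎-⇔ (⇔-id _ ×-⇔ sorted⇒∃≤⇔≤-first col σ sorted k)))
      ⇔-∘ yesNE⇔balanced∧coverCondition complete col ℓ
  where
  balanced⇔extremes : Balanced col (ℓ * k)
                      ⇔ (classSize col (σ ⟨$⟩ʳ zero) ≤ ℓ * k + classSize col (σ ⟨$⟩ʳ fromℕ m))
  balanced⇔extremes = sorted⇒balanced⇔ col σ sorted (ℓ * k)
  instance
    k≢0 : NonZero k
    k≢0 = >-nonZero 1≤k
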